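{- Let $d\geq 0$ and let $G$ be a $d$-leveled graph with $V(G)=I\sqcup X$, where $I$ is an independent set in $G$. Then $|I|\leq 2|X|^d$.
   Context: All graphs are finite and simple. For a clique $\sigma$ in $G$, $\mathrm{lk}_G\sigma$ is the subgraph of $G$ induced on the set of vertices adjacent to every vertex of $\sigma$. For an integer $d\geq 0$, a graph $G$ is $d$-leveled if (i) every maximal clique of $G$ has exactly $d+1$ vertices, and (ii) for every clique $\sigma$ with $d$ vertices, $\mathrm{lk}_G\sigma$ consists of exactly two vertices with no edge between them. -}

module Defs where

open import Data.Nat using (ℕ; suc)
open import Data.Fin using (Fin)
open import Data.Fin.Subset using (Subset; _∈_; _⊆_; ∣_∣)
open import Data.Product using (Σ; ∃; ∃₂; _×_)
open import Data.Sum using (_⊎_)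
open import Relation.Nullary using (¬_; Dec)
open import Relation.Binary.PropositionalEquality using (_≡_; _≢_)
open import Function.Bundles using (_⇔_)

record Graph (n : ℕ) : Set₁ where
  field
    Adj    : Fin n → Fin n → Set
    adj?   : ∀ u v → Dec (Adj u v)
    sym    : ∀ {u v} → Adj u v → Adj v u
    irrefl : ∀ {u} → ¬ Adj u u

module _ {n : ℕ} (G : Graph n) where
  open Graph G

  IsClique : Subset n → Set
  IsClique σ = ∀ {u v} → u ∈ σ → v ∈ σ → u ≢ v → Adj u v

  IsMaximalClique : Subset n → Set
  IsMaximalClique σ = IsClique σ × (∀ τ → IsClique τ → σ ⊆ τ → τ ⊆ σ)

  InLink : Subset n → Fin n → Set
  InLink σ v = ∀ {u} → u ∈ σ → Adj u v

  LinkIsTwoNonadjacent : Subset n → Set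
  LinkIsTwoNonadjacent σ =
    ∃₂ λ a b → a ≢ b × ¬ Adj a b × (∀ v → InLink σ v ⇔ (v ≡ a ⊎ v ≡ b))

  IsIndependent : Subset n → Set
  IsIndependent I = ∀ {u v} → u ∈ I → v ∈ I → ¬ Adj u v

IsLeveled : ∀ {n} → ℕ → Graph n → Set
IsLeveled d G =
    (∀ σ → IsMaximalClique G σ → ∣ σ ∣ ≡ suc d)
  × (∀ σ → IsClique G σ → ∣ σ ∣ ≡ d → LinkIsTwoNonadjacent G σ)

-- For every v ∈ I pick a maximal clique σ through v.  Its facet σ - v is a d-clique
-- (maximal cliques have d + 1 vertices) all of whose vertices are neighbours of v,
-- hence lie in X.  Conversely v lies in the link of its facet, and that link has
-- only two vertices, so at most two vertices of I share a facet.  Listing each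
-- facet as a d-tuple of vertices of X therefore maps I at most two-to-one into X^d.
module Submission where

open import Defs
open import Algebra.Properties.CommutativeSemigroup using (x∙yz≈y∙xz)
open import Data.Bool using (true; false; if_then_else_)
open import Data.Empty using (⊥-elim)
open import Data.Fin using (Fin; zero; suc)
open import Data.Fin.Properties using (_≟_; any?; all?)
open import Data.Fin.Subset using (Subset; _∈_; _∉_; _⊆_; _∪_; _─_; _-_; ⁅_⁆; ∁; ∣_∣)
open import Data.Fin.Subset.Properties
  using ( _∈?_; x∈p∪q⁻; x∈p∪q⁺; x∈⁅x⁆; x∈⁅y⁆⇒x≡y; x∉⁅y⁆⇒x≢y; p⊆p∪q; p─⊥≡p; p─q⊆p
        ; x∉p⇒x∈∁p)
open import Data.List as List using (List; allFin)
open import Data.List.Membership.Propositional using () renaming (_∈_ to _∈ˡ_)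
open import Data.List.Membership.Propositional.Properties using (∈-allFin)
open import Data.List.Relation.Unary.Any using (here; there)
open import Data.Nat using (ℕ; zero; suc; pred; _+_; _*_; _^_; _≤_; z≤n; s≤s)
open import Data.Nat.Properties
  using ( +-*-semiring; *-commutativeSemigroup; ≤-refl; ≤-trans; ≤-reflexive; +-mono-≤
        ; +-identityʳ; *-identityʳ; module ≤-Reasoning)
open import Data.Product using (∃; ∃₂; _×_; _,_; proj₁; proj₂)
open import Data.Sum using (_⊎_; inj₁; inj₂; map)
open import Data.Vec using ([]; _∷_; here; there)
open import Data.Vec.Functional as Vector using (Vector)
open import Function using (_∘_)
open import Function.Bundles using (Equivalence)
open import Level using (Level)
open import Relation.Binary.PropositionalEquality
  using (_≡_; _≢_; refl; sym; trans; cong; cong₂; _≗_; module ≡-Reasoning)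
open import Relation.Nullary using (¬_; Dec; yes; no; does)
open import Relation.Nullary.Decidable using (map′; _×-dec_; _⊎-dec_; _→-dec_)
open import Relation.Unary using (Pred; Decidable)

open import Algebra.Properties.Semiring.Sum +-*-semiring
  using (sum; sum-syntax; sum-cong-≗; sum-replicate-zero; ∑-comm; ∑-distrib-+; *-distribʳ-sum)

private
  variable
    a ℓ ℓ′ : Level
    A B : Set a
    m n k : ℕ

x∈p─q⇒x∉q : ∀ {x : Fin n} (p q : Subset n) → x ∈ p ─ q → x ∉ q
x∈p─q⇒x∉q (s ∷ p) (true ∷ q) () here
x∈p─q⇒x∉q (s ∷ p) (t ∷ q) (there x∈p─q) (there x∈q) = x∈p─q⇒x∉q p q x∈p─q x∈q

x∈p-y⇒x≢y : ∀ {x : Fin n} (p : Subset n) y → x ∈ p - y → x ≢ y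
x∈p-y⇒x≢y p y x∈p-y = x∉⁅y⁆⇒x≢y (x∈p─q⇒x∉q p ⁅ y ⁆ x∈p-y)

x∈p⇒∣p∣≡suc∣p-x∣ : ∀ {x : Fin n} (p : Subset n) → x ∈ p → ∣ p ∣ ≡ suc ∣ p - x ∣
x∈p⇒∣p∣≡suc∣p-x∣ (true ∷ p)  here          = cong (suc ∘ ∣_∣) (sym (p─⊥≡p p))
x∈p⇒∣p∣≡suc∣p-x∣ (true ∷ p)  (there x∈p)  = cong suc (x∈p⇒∣p∣≡suc∣p-x∣ p x∈p)
x∈p⇒∣p∣≡suc∣p-x∣ (false ∷ p) (there x∈p)  = x∈p⇒∣p∣≡suc∣p-x∣ p x∈p

record Enumeration (p : Subset n) (k : ℕ) : Set where
  field
    element   : Fin k → Fin n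
    element-∈ : ∀ i → element i ∈ p
    covers    : ∀ {x} → x ∈ p → ∃ λ i → element i ≡ x

enumeration : (p : Subset n) → Enumeration p ∣ p ∣
enumeration [] = record { element = λ () ; element-∈ = λ () ; covers = λ () }
enumeration (true ∷ p) = record
  { element   = λ { zero → zero ; (suc i) → suc (element i) }
  ; element-∈ = λ { zero → here ; (suc i) → there (element-∈ i) }
  ; covers    = λ { here → zero , refl ; (there x∈p) → let i , eq = covers x∈p in suc i , cong suc eq }
  }
  where open Enumeration (enumeration p)
enumeration (false ∷ p) = record
  { element   = suc ∘ element
  ; element-∈ = λ i → there (element-∈ i)
  ; covers    = λ { (there x∈p) → let i , eq = covers x∈p in i , cong suc eq }
  }
  where open Enumeration (enumeration p)

enumeration-of-size : (p : Subset n) → ∣ p ∣ ≡ k → Enumeration p k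
enumeration-of-size p refl = enumeration p

∑-mono-≤ : {f g : Vector ℕ n} → (∀ i → f i ≤ g i) → sum f ≤ sum g
∑-mono-≤ {zero}  f≤g = z≤n
∑-mono-≤ {suc n} f≤g = +-mono-≤ (f≤g zero) (∑-mono-≤ (f≤g ∘ suc))

indicator : Dec A → ℕ
indicator a? = if does a? then 1 else 0

indicator-mono : (a? : Dec A) (b? : Dec B) → (A → B) → indicator a? ≤ indicator b?
indicator-mono (yes a) (yes b) A→B = ≤-refl
indicator-mono (yes a) (no ¬b) A→B = ⊥-elim (¬b (A→B a))
indicator-mono (no ¬a) b?      A→B = z≤n

indicator-no : (a? : Dec A) → ¬ A → indicator a? ≡ 0
indicator-no (yes a) ¬a = ⊥-elim (¬a a)
indicator-no (no _)  ¬a = refl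

indicator-⊎ : (a? : Dec A) (b? : Dec B) → indicator (a? ⊎-dec b?) ≤ indicator a? + indicator b?
indicator-⊎ (yes a) b? = s≤s z≤n
indicator-⊎ (no ¬a) b? = ≤-refl

count : {P : Pred (Fin n) ℓ} → Decidable P → ℕ
count {n} P? = ∑[ v < n ] indicator (P? v)

count-∈≡∣∣ : (p : Subset n) → count (_∈? p) ≡ ∣ p ∣
count-∈≡∣∣ []          = refl
count-∈≡∣∣ (true ∷ p)  = cong suc (count-∈≡∣∣ p)
count-∈≡∣∣ (false ∷ p) = count-∈≡∣∣ p

count-singleton : (x : Fin n) → count (x ≟_) ≡ 1
count-singleton {suc n} zero    = cong suc (sum-replicate-zero n)
count-singleton {suc n} (suc x) = count-singleton x

count-⊎ : {P : Pred (Fin n) ℓ} (P? : Decidable P) {Q : Pred (Fin n) ℓ′} (Q? : Decidable Q) →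
  count (λ v → P? v ⊎-dec Q? v) ≤ count P? + count Q?
count-⊎ {n} P? Q? = begin
  count (λ v → P? v ⊎-dec Q? v)                      ≤⟨ ∑-mono-≤ (λ v → indicator-⊎ (P? v) (Q? v)) ⟩
  ∑[ v < n ] (indicator (P? v) + indicator (Q? v))   ≡⟨ ∑-distrib-+ (indicator ∘ P?) (indicator ∘ Q?) ⟩
  count P? + count Q?                                ∎
  where open ≤-Reasoning

module _ {P : Pred (Fin n) ℓ} (P? : Decidable P) where

  count-mono : {Q : Pred (Fin n) ℓ′} (Q? : Decidable Q) → (∀ {v} → P v → Q v) → count P? ≤ count Q?
  count-mono Q? P⊆Q = ∑-mono-≤ (λ v → indicator-mono (P? v) (Q? v) P⊆Q)

  count-empty : (∀ v → ¬ P v) → count P? ≡ 0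
  count-empty ¬P = trans (sum-cong-≗ (λ v → indicator-no (P? v) (¬P v))) (sum-replicate-zero n)

  count-≤-2 : (∀ {u} → P u → ∃₂ λ a b → ∀ {v} → P v → v ≡ a ⊎ v ≡ b) → count P? ≤ 2
  count-≤-2 covered with any? P?
  ... | no ∄P = ≤-trans (≤-reflexive (count-empty (λ v p → ∄P (v , p)))) z≤n
  ... | yes (u , p) with covered p
  ...   | a , b , a-or-b = begin
    count P?                          ≤⟨ count-mono (λ v → a ≟ v ⊎-dec b ≟ v) (map sym sym ∘ a-or-b) ⟩
    count (λ v → a ≟ v ⊎-dec b ≟ v)   ≤⟨ count-⊎ (a ≟_) (b ≟_) ⟩
    count (a ≟_) + count (b ≟_)       ≡⟨ cong₂ _+_ (count-singleton a) (count-singleton b) ⟩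
    2                                 ∎
    where open ≤-Reasoning

indicator≡∑-fibres : (a? : Dec A) (x : Fin m) → indicator a? ≡ ∑[ y < m ] indicator (a? ×-dec x ≟ y)
indicator≡∑-fibres         (yes a) x = sym (count-singleton x)
indicator≡∑-fibres {m = m} (no ¬a) x = sym (sum-replicate-zero m)

module _ {P : Pred (Fin n) ℓ} (P? : Decidable P) (f : Fin n → Fin m) where

  fibre : (y : Fin m) → Decidable (λ v → P v × f v ≡ y)
  fibre y v = P? v ×-dec f v ≟ y

  count≡∑-fibres : count P? ≡ ∑[ y < m ] count (fibre y)
  count≡∑-fibres = begin
    ∑[ v < n ] indicator (P? v)                    ≡⟨ sum-cong-≗ (λ v → indicator≡∑-fibres (P? v) (f v)) ⟩
    ∑[ v < n ] ∑[ y < m ] indicator (fibre y v)    ≡⟨ ∑-comm (λ v y → indicator (fibre y v)) ⟩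
    ∑[ y < m ] ∑[ v < n ] indicator (fibre y v)    ∎
    where open ≡-Reasoning

  count-≤-by-fibres : {Q : Pred (Fin m) ℓ′} (Q? : Decidable Q) {c : ℕ} →
    (∀ {v} → P v → Q (f v)) → (∀ {y} → Q y → count (fibre y) ≤ c) → count P? ≤ count Q? * c
  count-≤-by-fibres Q? {c} f-maps fibre-bound = begin
    count P?                            ≡⟨ count≡∑-fibres ⟩
    ∑[ y < m ] count (fibre y)          ≤⟨ ∑-mono-≤ fibre-≤ ⟩
    ∑[ y < m ] (indicator (Q? y) * c)   ≡⟨ *-distribʳ-sum c (indicator ∘ Q?) ⟨
    count Q? * c                        ∎
    where
    open ≤-Reasoning
    fibre-≤ : ∀ y → count (fibre y) ≤ indicator (Q? y) * c
    fibre-≤ y with Q? y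
    ... | yes q = ≤-trans (fibre-bound q) (≤-reflexive (sym (+-identityʳ c)))
    ... | no ¬q = ≤-reflexive (count-empty (fibre y) λ { v (p , refl) → ¬q (f-maps p) })

_≗?_ : (g g′ : Vector (Fin m) k) → Dec (g ≗ g′)
g ≗? g′ = all? (λ i → g i ≟ g′ i)

tuple-fibre : {P : Pred (Fin n) ℓ} → Decidable P → (h : Fin n → Vector (Fin m) k) →
  (g : Vector (Fin m) k) → Decidable (λ v → P v × h v ≗ g)
tuple-fibre P? h g v = P? v ×-dec h v ≗? g

count-≤-by-tuple-fibres : {P : Pred (Fin n) ℓ} (P? : Decidable P) {Q : Pred (Fin m) ℓ′} (Q? : Decidable Q) →
  ∀ {c} d (h : Fin n → Vector (Fin m) d) →
  (∀ {v} → P v → ∀ i → Q (h v i)) → (∀ g → count (tuple-fibre P? h g) ≤ c) →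
  count P? ≤ c * count Q? ^ d
count-≤-by-tuple-fibres P? Q? {c} zero h h-maps fibre-bound = begin
  count P?                         ≤⟨ count-mono P? (tuple-fibre P? h (λ ())) (λ p → p , λ ()) ⟩
  count (tuple-fibre P? h (λ ()))  ≤⟨ fibre-bound (λ ()) ⟩
  c                                ≡⟨ *-identityʳ c ⟨
  c * 1                            ∎
  where open ≤-Reasoning
count-≤-by-tuple-fibres {n = n} {m = m} {P = P} P? {Q} Q? {c} (suc d) h h-maps fibre-bound = begin
  count P?                        ≤⟨ count-≤-by-fibres P? hd Q? (λ p → h-maps p zero) hd-fibre-bound ⟩
  count Q? * (c * count Q? ^ d)   ≡⟨ x∙yz≈y∙xz *-commutativeSemigroup (count Q?) c _ ⟩
  c * count Q? ^ suc d            ∎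
  where
  open ≤-Reasoning
  hd : Fin n → Fin m
  hd v = h v zero
  tl : Fin n → Vector (Fin m) d
  tl v i = h v (suc i)
  hd-fibre-bound : ∀ {y} → Q y → count (fibre P? hd y) ≤ c * count Q? ^ d
  hd-fibre-bound {y} _ =
    count-≤-by-tuple-fibres (fibre P? hd y) Q? d tl (λ (p , _) i → h-maps p (suc i)) λ g → begin
      count (tuple-fibre (fibre P? hd y) tl g)
        ≤⟨ count-mono (tuple-fibre (fibre P? hd y) tl g) (tuple-fibre P? h (y Vector.∷ g)) cons ⟩
      count (tuple-fibre P? h (y Vector.∷ g))
        ≤⟨ fibre-bound (y Vector.∷ g) ⟩
      c ∎
    where
    cons : ∀ {v g} → (P v × hd v ≡ y) × tl v ≗ g → P v × h v ≗ (y Vector.∷ g)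
    cons ((p , refl) , eq) = p , λ { zero → refl ; (suc i) → eq i }

module _ (G : Graph n) where
  open Graph G renaming (sym to adj-sym)

  inLink? : ∀ σ w → Dec (InLink G σ w)
  inLink? σ w = map′ (λ f {u} → f u) (λ f u → f) (all? (λ u → u ∈? σ →-dec adj? u w))

  InLink-antitone : ∀ {σ σ′ w} → σ ⊆ σ′ → InLink G σ′ w → InLink G σ w
  InLink-antitone σ⊆σ′ w∈lk u∈σ = w∈lk (σ⊆σ′ u∈σ)

  ⁅⁆-clique : ∀ v → IsClique G ⁅ v ⁆
  ⁅⁆-clique v u∈ w∈ u≢w = ⊥-elim (u≢w (trans (x∈⁅y⁆⇒x≡y v u∈) (sym (x∈⁅y⁆⇒x≡y v w∈))))

  ∪⁅⁆-clique : ∀ {σ w} → IsClique G σ → InLink G σ w → IsClique G (σ ∪ ⁅ w ⁆)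
  ∪⁅⁆-clique {σ} {w} σ-clique w∈lk u∈ v∈ u≢v with x∈p∪q⁻ σ ⁅ w ⁆ u∈ | x∈p∪q⁻ σ ⁅ w ⁆ v∈
  ... | inj₁ u∈σ | inj₁ v∈σ = σ-clique u∈σ v∈σ u≢v
  ... | inj₁ u∈σ | inj₂ v∈w rewrite x∈⁅y⁆⇒x≡y w v∈w = w∈lk u∈σ
  ... | inj₂ u∈w | inj₁ v∈σ rewrite x∈⁅y⁆⇒x≡y w u∈w = adj-sym (w∈lk v∈σ)
  ... | inj₂ u∈w | inj₂ v∈w = ⊥-elim (u≢v (trans (x∈⁅y⁆⇒x≡y w u∈w) (sym (x∈⁅y⁆⇒x≡y w v∈w))))

  extend : Subset n → Fin n → Subset n
  extend σ w with inLink? σ w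
  ... | yes _ = σ ∪ ⁅ w ⁆
  ... | no  _ = σ

  extend-⊇ : ∀ σ w → σ ⊆ extend σ w
  extend-⊇ σ w with inLink? σ w
  ... | yes _ = p⊆p∪q ⁅ w ⁆
  ... | no  _ = λ u∈σ → u∈σ

  extend-clique : ∀ {σ} w → IsClique G σ → IsClique G (extend σ w)
  extend-clique {σ} w σ-clique with inLink? σ w
  ... | yes w∈lk = ∪⁅⁆-clique σ-clique w∈lk
  ... | no  _    = σ-clique

  extend-saturates : ∀ σ w → w ∈ extend σ w ⊎ ¬ InLink G (extend σ w) w
  extend-saturates σ w with inLink? σ w
  ... | yes _    = inj₁ (x∈p∪q⁺ (inj₂ (x∈⁅x⁆ w)))
  ... | no  w∉lk = inj₂ w∉lk

  greedy : Subset n → List (Fin n) → Subset n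
  greedy = List.foldl extend

  greedy-⊇ : ∀ σ ws → σ ⊆ greedy σ ws
  greedy-⊇ σ List.[]       = λ u∈σ → u∈σ
  greedy-⊇ σ (w List.∷ ws) = greedy-⊇ (extend σ w) ws ∘ extend-⊇ σ w

  greedy-clique : ∀ {σ} ws → IsClique G σ → IsClique G (greedy σ ws)
  greedy-clique List.[]       σ-clique = σ-clique
  greedy-clique (w List.∷ ws) σ-clique = greedy-clique ws (extend-clique w σ-clique)

  greedy-saturates : ∀ σ {w ws} → w ∈ˡ ws → w ∈ greedy σ ws ⊎ ¬ InLink G (greedy σ ws) w
  greedy-saturates σ {ws = w List.∷ ws} (here refl) with extend-saturates σ w
  ... | inj₁ w∈   = inj₁ (greedy-⊇ _ ws w∈)
  ... | inj₂ w∉lk = inj₂ (w∉lk ∘ InLink-antitone (greedy-⊇ _ ws))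
  greedy-saturates σ {ws = u List.∷ ws} (there w∈ws) = greedy-saturates (extend σ u) w∈ws

  saturated⇒maximal : ∀ {σ} → IsClique G σ → (∀ w → w ∈ σ ⊎ ¬ InLink G σ w) → IsMaximalClique G σ
  saturated⇒maximal {σ} σ-clique saturated = σ-clique , maximal
    where
    maximal : ∀ τ → IsClique G τ → σ ⊆ τ → τ ⊆ σ
    maximal τ τ-clique σ⊆τ {x} x∈τ with x ∈? σ | saturated x
    ... | yes x∈σ | _         = x∈σ
    ... | no  _   | inj₁ x∈σ  = x∈σ
    ... | no  x∉σ | inj₂ x∉lk =
      ⊥-elim (x∉lk (λ u∈σ → τ-clique (σ⊆τ u∈σ) x∈τ (λ { refl → x∉σ u∈σ })))

  maximalClique : ∀ v → ∃ λ σ → v ∈ σ × IsMaximalClique G σ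
  maximalClique v = greedy ⁅ v ⁆ (allFin n)
                  , greedy-⊇ ⁅ v ⁆ (allFin n) (x∈⁅x⁆ v)
                  , saturated⇒maximal (greedy-clique (allFin n) (⁅⁆-clique v))
                                      (λ w → greedy-saturates ⁅ v ⁆ (∈-allFin w))

module LeveledGraph {d} (G : Graph n) (leveled : IsLeveled d G) where

  clique : Fin n → Subset n
  clique v = proj₁ (maximalClique G v)

  facet : Fin n → Subset n
  facet v = clique v - v

  v∈clique : ∀ v → v ∈ clique v
  v∈clique v = proj₁ (proj₂ (maximalClique G v))

  clique-maximal : ∀ v → IsMaximalClique G (clique v)
  clique-maximal v = proj₂ (proj₂ (maximalClique G v))

  facet-clique : ∀ v → IsClique G (facet v)
  facet-clique v x∈ y∈ = proj₁ (clique-maximal v) (p─q⊆p _ _ x∈) (p─q⊆p _ _ y∈)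

  facet-size : ∀ v → ∣ facet v ∣ ≡ d
  facet-size v = cong pred (trans (sym (x∈p⇒∣p∣≡suc∣p-x∣ (clique v) (v∈clique v)))
                                  (proj₁ leveled (clique v) (clique-maximal v)))

  ∈-link-facet : ∀ v → InLink G (facet v) v
  ∈-link-facet v u∈ = proj₁ (clique-maximal v) (p─q⊆p _ _ u∈) (v∈clique v) (x∈p-y⇒x≢y (clique v) v u∈)

  facet-enumeration : ∀ v → Enumeration (facet v) d
  facet-enumeration v = enumeration-of-size (facet v) (facet-size v)

  facet-vertex : Fin n → Vector (Fin n) d
  facet-vertex v = Enumeration.element (facet-enumeration v)

  facet-vertex-∈ : ∀ v i → facet-vertex v i ∈ facet v
  facet-vertex-∈ v = Enumeration.element-∈ (facet-enumeration v)

  same-facet-vertices⇒∈-link : ∀ {u v} → facet-vertex u ≗ facet-vertex v → InLink G (facet u) v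
  same-facet-vertices⇒∈-link {u} {v} eq x∈ with Enumeration.covers (facet-enumeration u) x∈
  ... | i , refl rewrite eq i = ∈-link-facet v (facet-vertex-∈ v i)

  tuple-fibre-≤-2 : {P : Pred (Fin n) ℓ} (P? : Decidable P) (g : Vector (Fin n) d) →
    count (tuple-fibre P? facet-vertex g) ≤ 2
  tuple-fibre-≤-2 {P = P} P? g = count-≤-2 (tuple-fibre P? facet-vertex g) covered
    where
    covered : ∀ {u} → P u × facet-vertex u ≗ g →
              ∃₂ λ a b → ∀ {v} → P v × facet-vertex v ≗ g → v ≡ a ⊎ v ≡ b
    covered {u} (_ , u≗g) with proj₂ leveled (facet u) (facet-clique u) (facet-size u)
    ... | a , b , _ , _ , link≡ab = a , b , λ (_ , v≗g) →
      Equivalence.to (link≡ab _) (same-facet-vertices⇒∈-link (λ i → trans (u≗g i) (sym (v≗g i))))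

  facet-vertices-outside : ∀ {I} → IsIndependent G I → ∀ {v} → v ∈ I → ∀ i → facet-vertex v i ∈ ∁ I
  facet-vertices-outside independent v∈I i =
    x∉p⇒x∈∁p (λ x∈I → independent x∈I v∈I (∈-link-facet _ (facet-vertex-∈ _ i)))

lemma3p1 : (d n : ℕ) (G : Graph n) → IsLeveled d G →
    (I : Subset n) → IsIndependent G I →
    ∣ I ∣ ≤ 2 * (∣ ∁ I ∣ ^ d)
lemma3p1 d n G leveled I independent = begin
  ∣ I ∣                       ≡⟨ count-∈≡∣∣ I ⟨
  count (_∈? I)               ≤⟨ count-≤-by-tuple-fibres (_∈? I) (_∈? ∁ I) d facet-vertex
                                   (facet-vertices-outside independent) (tuple-fibre-≤-2 (_∈? I)) ⟩
  2 * count (_∈? ∁ I) ^ d     ≡⟨ cong (λ x → 2 * x ^ d) (count-∈≡∣∣ (∁ I)) ⟩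
  2 * ∣ ∁ I ∣ ^ d             ∎
  where
  open ≤-Reasoning
  open LeveledGraph G leveled
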